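{- Let $n\geq k\geq 1$, let $S\neq T$ be $k$-subsets of $[n]$, and let $C$ be a non-trivial component of $h(S,T)$. Then $x_{max}(C)$ and $y_{min}(C)$ are adjacent in $h(S,T)$.
   Context: $[m]=\{1,\dots,m\}$. For a $k$-subset $S$ of $[n]$ define $f(S)\subseteq([n]\setminus[k])\times[k]$: if $S=[k]$ then $f(S)=\emptyset$; otherwise let $S\setminus[k]=\{x_1,\dots,x_t\}$ with $n\geq x_1>\dots>x_t\geq k+1$ and $[k]\setminus S=\{y_1,\dots,y_t\}$ with $1\leq y_1<\dots<y_t\leq k$, and set $f(S)=\{(x_1,y_1),\dots,(x_t,y_t)\}$. Let $h(S)$ be the graph on $[n]$ whose edges are the pairs $\{x,y\}$ with $(x,y)\in f(S)$, and $h(S,T)$ the multigraph union of $h(S)$ and $h(T)$. A non-trivial component is a connected component with at least one edge. For such $C$ (viewed as its vertex set): $x_{max}(C)=\max(C\cap([n]\setminus[k]))$, $y_{min}(C)=\min(C\cap[k])$. -}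

module Defs where

open import Data.Nat using (ℕ; zero; suc; _+_; _∸_; _≤_; _<_)
open import Data.Bool using (Bool; true; false; not)
open import Data.Vec using (Vec; []; _∷_)
open import Data.List using (List; map; upTo; reverse; zip; filterᵇ)
open import Data.List.Membership.Propositional using (_∈_)
open import Data.Product using (_×_; _,_)
open import Data.Sum using (_⊎_)
open import Data.Fin.Subset using (Subset)
open import Relation.Binary.Construct.Closure.ReflexiveTransitive using (Star)

-- Vertex set [n] = {1,…,n} is represented by natural numbers 1..n.
-- A subset S of [n] is a 'Subset n' (Vec Bool n); the element i (1 ≤ i ≤ n)
-- belongs to S iff position i-1 of S is true.
mem : ∀ {n} → Subset n → ℕ → Bool
mem []      _             = false
mem (b ∷ v) zero          = false
mem (b ∷ v) (suc zero)    = b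
mem (b ∷ v) (suc (suc m)) = mem v (suc m)

-- S \ [k] listed in decreasing order: x₁ > x₂ > … > x_t
xsOf : ∀ {n} → ℕ → Subset n → List ℕ
xsOf {n} k S = filterᵇ (mem S) (reverse (map (λ i → suc (k + i)) (upTo (n ∸ k))))

-- [k] \ S listed in increasing order: y₁ < y₂ < … < y_t
ysOf : ∀ {n} → ℕ → Subset n → List ℕ
ysOf k S = filterᵇ (λ y → not (mem S y)) (map suc (upTo k))

f : ∀ {n} → ℕ → Subset n → List (ℕ × ℕ)
f k S = zip (xsOf k S) (ysOf k S)

AdjH : ∀ {n} → ℕ → Subset n → ℕ → ℕ → Set
AdjH k S u v = ((u , v) ∈ f k S) ⊎ ((v , u) ∈ f k S)

AdjHH : ∀ {n} → ℕ → Subset n → Subset n → ℕ → ℕ → Set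
AdjHH k S T u v = AdjH k S u v ⊎ AdjH k T u v

Comp : ∀ {n} → ℕ → Subset n → Subset n → ℕ → ℕ → Set
Comp k S T v z = Star (AdjHH k S T) v z

IsXmax : ℕ → ℕ → (ℕ → Set) → ℕ → Set
IsXmax n k C x = (C x × k < x × x ≤ n) × (∀ z → C z → k < z → z ≤ n → z ≤ x)

IsYmin : ℕ → (ℕ → Set) → ℕ → Set
IsYmin k C y = (C y × 1 ≤ y × y ≤ k) × (∀ z → C z → 1 ≤ z → z ≤ k → y ≤ z)

module Submission where

open import Defs
open import Data.Nat using (ℕ; _≤_)
open import Data.Product using (∃)
open import Data.Fin.Subset using (Subset; ∣_∣)
open import Relation.Binary.PropositionalEquality using (_≡_; _≢_)

open import Data.Nat using (suc; _+_; _∸_; _<_; s≤s; z≤n; _≟_)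
open import Data.Nat.Properties
  using (≤-antisym; ≤-refl; <⇒≱; <-irrefl; <⇒≤; +-monoʳ-<; +-monoʳ-≤; +-suc; m≤m+n; m+[n∸m]≡n)
open import Data.Bool using (not; T?)
open import Data.List using (List; []; _∷_; zip; reverse; filterᵇ; applyUpTo; applyDownFrom)
open import Data.List.Properties using (map-upTo; reverse-applyUpTo)
open import Data.List.Membership.Propositional using (_∈_; _∉_)
open import Data.List.Membership.Propositional.Properties using (∈-filter⁻; ∈-applyDownFrom⁻; ∈-applyUpTo⁻)
open import Data.List.Relation.Unary.Any using (here; there)
open import Data.List.Relation.Unary.All as All using (All; []; _∷_)
open import Data.List.Relation.Unary.AllPairs using (AllPairs; []; _∷_)
import Data.List.Relation.Unary.AllPairs.Properties as AllPairs
open import Data.Product as Product using (_×_; _,_; proj₁; proj₂)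
open import Data.Sum as Sum using (_⊎_; inj₁; inj₂)
open import Data.Empty using (⊥-elim)
open import Relation.Nullary using (¬_; yes; no)
open import Relation.Binary.Core using (Rel)
open import Relation.Binary.Definitions using (Symmetric)
open import Relation.Binary.PropositionalEquality using (refl; sym; trans; cong; subst)
open import Relation.Binary.Construct.Closure.ReflexiveTransitive as Star using (Star; ε; _◅_; _◅◅_)
open import Function using (_∘_; flip)
open import Level using (0ℓ)

-- The arcs of f(S) join the elements of S above k, taken in decreasing order, to the
-- elements of [k] missing from S, taken in increasing order, so they are pairwise nested:
-- h(S,T) is the union of two nested matchings. If x = x_max(C) is matched to p in one of
-- them, in which y = y_min(C) is matched to some u ∈ C, then u ≤ x and nesting give p ≤ y,
-- while p ∈ C gives y ≤ p. Such a common matching exists: if x is matched in h(T) only,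
-- C is the alternating path leaving x along an h(T)-arc, and every vertex of [k] on it is
-- entered through an h(T)-arc.

∈-zip⁻ : ∀ {A B : Set} {xs : List A} {ys : List B} {a b} → (a , b) ∈ zip xs ys → a ∈ xs × b ∈ ys
∈-zip⁻ {xs = x ∷ xs} {y ∷ ys} (here refl) = here refl , here refl
∈-zip⁻ {xs = x ∷ xs} {y ∷ ys} (there p) = Product.map there there (∈-zip⁻ p)

All-zip⁺ : ∀ {A B : Set} {P : A → Set} {Q : B → Set} {xs ys} →
           All P xs → All Q ys → All (λ q → P (proj₁ q) × Q (proj₂ q)) (zip xs ys)
All-zip⁺ []         _          = []
All-zip⁺ (_ ∷ _)    []         = []
All-zip⁺ (px ∷ pxs) (qy ∷ qys) = (px , qy) ∷ All-zip⁺ pxs qys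

AllPairs-zip⁺ : ∀ {A B : Set} {R : Rel A 0ℓ} {S : Rel B 0ℓ} {xs ys} → AllPairs R xs → AllPairs S ys →
                AllPairs (λ p q → R (proj₁ p) (proj₁ q) × S (proj₂ p) (proj₂ q)) (zip xs ys)
AllPairs-zip⁺ []         _          = []
AllPairs-zip⁺ (_ ∷ _)    []         = []
AllPairs-zip⁺ (px ∷ pxs) (qy ∷ qys) = All-zip⁺ px qy ∷ AllPairs-zip⁺ pxs qys

AllPairs-∈-trichotomy : ∀ {A : Set} {R : Rel A 0ℓ} {xs a b} → AllPairs R xs → a ∈ xs → b ∈ xs →
                        R a b ⊎ a ≡ b ⊎ R b a
AllPairs-∈-trichotomy (_  ∷ _)  (here refl) (here refl) = inj₂ (inj₁ refl)
AllPairs-∈-trichotomy (ra ∷ _)  (here refl) (there q)   = inj₁ (All.lookup ra q)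
AllPairs-∈-trichotomy (rb ∷ _)  (there p)   (here refl) = inj₂ (inj₂ (All.lookup rb p))
AllPairs-∈-trichotomy (_  ∷ rs) (there p)   (there q)   = AllPairs-∈-trichotomy rs p q

Nested : Rel (ℕ × ℕ) 0ℓ
Nested p q = proj₁ q < proj₁ p × proj₂ p < proj₂ q

record NestedMatching (n k : ℕ) (L : List (ℕ × ℕ)) : Set where
  field
    top-range    : ∀ {a b} → (a , b) ∈ L → k < a × a ≤ n
    bottom-range : ∀ {a b} → (a , b) ∈ L → 1 ≤ b × b ≤ k
    nested       : AllPairs Nested L

module NestedMatchingProperties {n k L} (M : NestedMatching n k L) where
  open NestedMatching M

  top≰k : ∀ {a b} → (a , b) ∈ L → ¬ a ≤ k
  top≰k m = <⇒≱ (proj₁ (top-range m))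

  bottom≤k : ∀ {a b} → (a , b) ∈ L → b ≤ k
  bottom≤k m = proj₂ (bottom-range m)

  antitone : ∀ {a b a' b'} → (a , b) ∈ L → (a' , b') ∈ L → a ≤ a' → b' ≤ b
  antitone p q a≤a' with AllPairs-∈-trichotomy nested p q
  ... | inj₁ (a'<a , _)      = ⊥-elim (<⇒≱ a'<a a≤a')
  ... | inj₂ (inj₁ refl)     = ≤-refl
  ... | inj₂ (inj₂ (_ , b'<b)) = <⇒≤ b'<b

  unique-bottom : ∀ {a b b'} → (a , b) ∈ L → (a , b') ∈ L → b ≡ b'
  unique-bottom p q = ≤-antisym (antitone q p ≤-refl) (antitone p q ≤-refl)

  unique-top : ∀ {a a' b} → (a , b) ∈ L → (a' , b) ∈ L → a ≡ a'
  unique-top p q with AllPairs-∈-trichotomy nested p q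
  ... | inj₁ (_ , b<b)         = ⊥-elim (<-irrefl refl b<b)
  ... | inj₂ (inj₁ refl)       = refl
  ... | inj₂ (inj₂ (_ , b<b))  = ⊥-elim (<-irrefl refl b<b)

module _ {n : ℕ} (k : ℕ) (S : Subset n) where
  private
    shift : ℕ → ℕ
    shift i = suc (k + i)

    xsOf-applyDownFrom : xsOf {n} k S ≡ filterᵇ (mem S) (applyDownFrom shift (n ∸ k))
    xsOf-applyDownFrom = cong (filterᵇ (mem S))
      (trans (cong reverse (map-upTo shift (n ∸ k))) (reverse-applyUpTo shift (n ∸ k)))

    ysOf-applyUpTo : ysOf k S ≡ filterᵇ (not ∘ mem S) (applyUpTo suc k)
    ysOf-applyUpTo = cong (filterᵇ (not ∘ mem S)) (map-upTo suc k)

  xsOf-decreasing : AllPairs (flip _<_) (xsOf {n} k S)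
  xsOf-decreasing = subst (AllPairs (flip _<_)) (sym xsOf-applyDownFrom)
    (AllPairs.filter⁺ (T? ∘ mem S)
      (AllPairs.applyDownFrom⁺₁ shift (n ∸ k) (λ j<i _ → s≤s (+-monoʳ-< k j<i))))

  ysOf-increasing : AllPairs _<_ (ysOf k S)
  ysOf-increasing = subst (AllPairs _<_) (sym ysOf-applyUpTo)
    (AllPairs.filter⁺ (T? ∘ not ∘ mem S)
      (AllPairs.applyUpTo⁺₁ suc k (λ i<j _ → s≤s i<j)))

  xsOf-range : k ≤ n → ∀ {a} → a ∈ xsOf {n} k S → k < a × a ≤ n
  xsOf-range k≤n a∈xs
    with i , i<n∸k , refl ← ∈-applyDownFrom⁻ shift {n = n ∸ k}
           (proj₁ (∈-filter⁻ (T? ∘ mem S) {xs = applyDownFrom shift (n ∸ k)} (subst (_ ∈_) xsOf-applyDownFrom a∈xs)))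
    = s≤s (m≤m+n k i) ,
      subst (suc (k + i) ≤_) (m+[n∸m]≡n k≤n) (subst (_≤ k + (n ∸ k)) (+-suc k i) (+-monoʳ-≤ k i<n∸k))

  ysOf-range : ∀ {b} → b ∈ ysOf k S → 1 ≤ b × b ≤ k
  ysOf-range b∈ys
    with _ , i<k , refl ← ∈-applyUpTo⁻ suc {n = k}
           (proj₁ (∈-filter⁻ (T? ∘ not ∘ mem S) {xs = applyUpTo suc k} (subst (_ ∈_) ysOf-applyUpTo b∈ys)))
    = s≤s z≤n , i<k

  f-nestedMatching : k ≤ n → NestedMatching n k (f k S)
  f-nestedMatching k≤n = record
    { top-range    = xsOf-range k≤n ∘ proj₁ ∘ ∈-zip⁻
    ; bottom-range = ysOf-range ∘ proj₂ ∘ ∈-zip⁻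
    ; nested       = AllPairs-zip⁺ xsOf-decreasing ysOf-increasing
    }

Edge : List (ℕ × ℕ) → Rel ℕ 0ℓ
Edge L u v = (u , v) ∈ L ⊎ (v , u) ∈ L

Edge² : List (ℕ × ℕ) → List (ℕ × ℕ) → Rel ℕ 0ℓ
Edge² A B u v = Edge A u v ⊎ Edge B u v

Edge²-sym : ∀ {A B} → Symmetric (Edge² A B)
Edge²-sym = Sum.map Sum.swap Sum.swap

Edge²-swap : ∀ {A B u v} → Edge² A B u v → Edge² B A u v
Edge²-swap = Sum.swap

partner? : (L : List (ℕ × ℕ)) (x : ℕ) → (∃ λ w → (x , w) ∈ L) ⊎ (∀ w → (x , w) ∉ L)
partner? []            x = inj₂ λ _ ()
partner? ((a , b) ∷ L) x with a ≟ x | partner? L x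
... | yes refl | _              = inj₁ (b , here refl)
... | no _     | inj₁ (w , x∈L) = inj₁ (w , there x∈L)
... | no a≢x   | inj₂ none      = inj₂ λ { w (here refl) → a≢x refl ; w (there x∈L) → none w x∈L }

neighbour-in-component : ∀ {a ℓ} {V : Set a} {R : Rel V ℓ} → Symmetric R → ∀ {v z} →
                         Star R v z → ∃ (R v) → ∃ λ u → R z u × Star R v u
neighbour-in-component R-sym ε        (w , vRw) = w , vRw , vRw ◅ ε
neighbour-in-component R-sym (r ◅ rs) _
  with u , zRu , ru ← neighbour-in-component R-sym rs (_ , R-sym r) = u , zRu , r ◅ ru

module Alternating {n k A B} (MA : NestedMatching n k A) (MB : NestedMatching n k B) where
  private
    module A = NestedMatchingProperties MA
    module B = NestedMatchingProperties MB

  data AltWalk (x : ℕ) : ℕ → Set where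
    start : AltWalk x x
    _▷B_  : ∀ {a b} → AltWalk x a → (a , b) ∈ B → AltWalk x b
    _◁A_  : ∀ {a b} → AltWalk x a → (b , a) ∈ A → AltWalk x b

  AltWalk⇒Star : ∀ {x z} → AltWalk x z → Star (Edge² A B) x z
  AltWalk⇒Star start    = ε
  AltWalk⇒Star (w ▷B m) = AltWalk⇒Star w ◅◅ (inj₂ (inj₁ m) ◅ ε)
  AltWalk⇒Star (w ◁A m) = AltWalk⇒Star w ◅◅ (inj₁ (inj₂ m) ◅ ε)

  module _ {x} (k<x : k < x) (no-A-partner : ∀ w → (x , w) ∉ A) where
    AltWalk-step : ∀ {z w} → AltWalk x z → Edge² A B z w → AltWalk x w
    AltWalk-step start      (inj₁ (inj₁ m)) = ⊥-elim (no-A-partner _ m)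
    AltWalk-step (_ ▷B m')  (inj₁ (inj₁ m)) = ⊥-elim (A.top≰k m (B.bottom≤k m'))
    AltWalk-step (aw ◁A m') (inj₁ (inj₁ m)) = subst (AltWalk x) (A.unique-bottom m' m) aw
    AltWalk-step aw         (inj₁ (inj₂ m)) = aw ◁A m
    AltWalk-step aw         (inj₂ (inj₁ m)) = aw ▷B m
    AltWalk-step start      (inj₂ (inj₂ m)) = ⊥-elim (<⇒≱ k<x (B.bottom≤k m))
    AltWalk-step (aw ▷B m') (inj₂ (inj₂ m)) = subst (AltWalk x) (B.unique-top m' m) aw
    AltWalk-step (_ ◁A m')  (inj₂ (inj₂ m)) = ⊥-elim (A.top≰k m' (B.bottom≤k m))

    AltWalk-star : ∀ {z w} → AltWalk x z → Star (Edge² A B) z w → AltWalk x w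
    AltWalk-star aw ε        = aw
    AltWalk-star aw (e ◅ es) = AltWalk-star (AltWalk-step aw e) es

    AltWalk-bottom : ∀ {z} → AltWalk x z → z ≤ k → ∃ λ u → (u , z) ∈ B × AltWalk x u
    AltWalk-bottom start     z≤k = ⊥-elim (<⇒≱ k<x z≤k)
    AltWalk-bottom (aw ▷B m) _   = _ , m , aw
    AltWalk-bottom (_ ◁A m)  z≤k = ⊥-elim (A.top≰k m z≤k)

    bottom-reached-through-B : ∀ {z} → Star (Edge² A B) x z → z ≤ k →
                               ∃ λ u → (u , z) ∈ B × Star (Edge² A B) x u
    bottom-reached-through-B xz z≤k
      with u , m , aw ← AltWalk-bottom (AltWalk-star start xz) z≤k = u , m , AltWalk⇒Star aw

module ComponentExtremes {n k A B} (MA : NestedMatching n k A) (MB : NestedMatching n k B)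
  {v x y : ℕ} (x-max : IsXmax n k (Star (Edge² A B) v) x) (y-min : IsYmin k (Star (Edge² A B) v) y)
  where
  private
    module A = NestedMatchingProperties MA
    module B = NestedMatchingProperties MB
    _~_ : Rel ℕ 0ℓ
    _~_ = Star (Edge² A B)

    v~x : v ~ x
    v~x = proj₁ (proj₁ x-max)

    k<x : k < x
    k<x = proj₁ (proj₂ (proj₁ x-max))

    v~y : v ~ y
    v~y = proj₁ (proj₁ y-min)

    y≤k : y ≤ k
    y≤k = proj₂ (proj₂ (proj₁ y-min))

    x~y : x ~ y
    x~y = Star.reverse Edge²-sym v~x ◅◅ v~y

  x-matched-to-y : ∀ {L p u} → NestedMatching n k L → (∀ {a b} → (a , b) ∈ L → Edge² A B a b) →
                   (x , p) ∈ L → (u , y) ∈ L → v ~ u → (x , y) ∈ L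
  x-matched-to-y {L} {p} {u} M edge xp uy v~u = subst (λ b → (x , b) ∈ L) (≤-antisym p≤y y≤p) xp
    where
      open NestedMatching M
      open NestedMatchingProperties M
      u≤x : u ≤ x
      u≤x = proj₂ x-max _ v~u (proj₁ (top-range uy)) (proj₂ (top-range uy))
      p≤y : p ≤ y
      p≤y = antitone uy xp u≤x
      y≤p : y ≤ p
      y≤p = proj₂ y-min _ (v~x ◅◅ (edge xp ◅ ε)) (proj₁ (bottom-range xp)) (proj₂ (bottom-range xp))

  xmax-adjacent-ymin : ∃ (Edge² A B v) → Edge² A B x y
  xmax-adjacent-ymin nontrivial with partner? A x | partner? B x
  xmax-adjacent-ymin nontrivial | inj₁ (_ , xa) | inj₁ (_ , xb)
    with neighbour-in-component Edge²-sym v~y nontrivial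
  ...   | _ , inj₁ (inj₁ ya) , _   = ⊥-elim (A.top≰k ya y≤k)
  ...   | _ , inj₁ (inj₂ ua) , v~u = inj₁ (inj₁ (x-matched-to-y MA (inj₁ ∘ inj₁) xa ua v~u))
  ...   | _ , inj₂ (inj₁ yb) , _   = ⊥-elim (B.top≰k yb y≤k)
  ...   | _ , inj₂ (inj₂ ub) , v~u = inj₂ (inj₁ (x-matched-to-y MB (inj₂ ∘ inj₁) xb ub v~u))
  xmax-adjacent-ymin _ | inj₂ no-A | inj₁ (_ , xb)
    with _ , ub , x~u ← Alternating.bottom-reached-through-B MA MB k<x no-A x~y y≤k
    = inj₂ (inj₁ (x-matched-to-y MB (inj₂ ∘ inj₁) xb ub (v~x ◅◅ x~u)))
  xmax-adjacent-ymin _ | inj₁ (_ , xa) | inj₂ no-B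
    with _ , ua , x~u ← Alternating.bottom-reached-through-B MB MA k<x no-B (Star.map Edge²-swap x~y) y≤k
    = inj₁ (inj₁ (x-matched-to-y MA (inj₁ ∘ inj₁) xa ua (v~x ◅◅ Star.map Edge²-swap x~u)))
  xmax-adjacent-ymin nontrivial | inj₂ no-A | inj₂ no-B
    with neighbour-in-component Edge²-sym v~x nontrivial
  ... | w , inj₁ (inj₁ xa) , _ = ⊥-elim (no-A w xa)
  ... | _ , inj₁ (inj₂ wa) , _ = ⊥-elim (<⇒≱ k<x (A.bottom≤k wa))
  ... | w , inj₂ (inj₁ xb) , _ = ⊥-elim (no-B w xb)
  ... | _ , inj₂ (inj₂ wb) , _ = ⊥-elim (<⇒≱ k<x (B.bottom≤k wb))

mainTheorem8 : (n k : ℕ) → 1 ≤ k → k ≤ n →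
    (S T : Subset n) → ∣ S ∣ ≡ k → ∣ T ∣ ≡ k → S ≢ T →
    (v : ℕ) → ∃ (λ w → AdjHH k S T v w) →
    (x y : ℕ) → IsXmax n k (Comp k S T v) x → IsYmin k (Comp k S T v) y →
    AdjHH k S T x y
mainTheorem8 n k _ k≤n S T _ _ _ v nontrivial x y x-max y-min =
  ComponentExtremes.xmax-adjacent-ymin
    (f-nestedMatching k S k≤n) (f-nestedMatching k T k≤n) x-max y-min nontrivial
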